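{- Let $\langle X_n : n \in \omega \rangle$ be a partition of $2^\omega$ into closed sets and for each $n \in \omega$ let $f_n \colon X_n \to \omega^\omega$ be continuous. Then there is a continuous function $f \colon 2^\omega \to \omega^\omega$ such that for every $n \in \omega$, every $x \in X_n$ and every $m \geq n$, $f(x)(m) = f_n(x)(m)$. -}

module Defs where

open import Data.Nat using (ℕ; _<_; _≤_)
open import Data.Bool using (Bool)
open import Data.Product using (Σ; ∃; ∃-syntax; _×_)
open import Relation.Binary.PropositionalEquality using (_≡_)

Cantor : Set
Cantor = ℕ → Bool

Baire : Set
Baire = ℕ → ℕ

Subset : Set₁
Subset = Cantor → Set

Agree : ℕ → Cantor → Cantor → Set
Agree k x y = ∀ i → i < k → x i ≡ y i

Closed : Subset → Set
Closed X = ∀ x → (∀ k → ∃[ y ] (X y × Agree k x y)) → X x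

IsPartition : (ℕ → Subset) → Set
IsPartition X =
  (∀ x → ∃[ n ] X n x) × (∀ x n n' → X n x → X n' x → n ≡ n')

-- A (proof-dependent) function X → ω^ω, continuous w.r.t. the subspace
-- topology on X and the product topology on ω^ω.
ContinuousOn : (X : Subset) → ((x : Cantor) → X x → Baire) → Set
ContinuousOn X g =
  ∀ x (p : X x) m → ∃[ k ] (∀ y (q : X y) → Agree k x y → g y q m ≡ g x p m)

Continuous : (Cantor → Baire) → Set
Continuous f = ∀ x m → ∃[ k ] (∀ y → Agree k x y → f y m ≡ f x m)

{-# OPTIONS --safe #-}
module Submission where

-- Each coordinate m is handled separately.  The pieces X 0, …, X m are
-- finitely many disjoint closed sets, so gluing the F j (j ≤ m) gives a
-- locally constant function on the closed set X 0 ∪ … ∪ X m.  A locally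
-- constant function on a nonempty closed C ⊆ 2^ω extends to all of 2^ω
-- by precomposing with a continuous retraction onto C, built greedily:
-- copy the bits of y as long as the prefix built so far still meets C,
-- and flip the bit otherwise.

open import Defs
open import Level using (0ℓ)
open import Axiom.ExcludedMiddle using (ExcludedMiddle)
open import Data.Bool using (not)
open import Data.Bool.Properties using (¬-not)
open import Data.Empty using (⊥-elim)
open import Data.Nat using (ℕ; zero; suc; _≤_; _<_; _⊔_; _≟_; z≤n)
open import Data.Nat.Properties
  using (≤-refl; ≤-pred; <-≤-trans; m≤n⇒m≤1+n; <⇒≤; <⇒≢; m≤n⇒m<n∨m≡n; m<1+n⇒m<n∨m≡n; m≤m⊔n; m≤n⊔m)
open import Data.Product using (Σ; ∃; ∃-syntax; _×_; _,_; proj₁; proj₂)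
open import Data.Sum using (inj₁; inj₂)
open import Relation.Nullary using (Dec; yes; no; ¬_; decidable-stable)
open import Relation.Binary.PropositionalEquality using (_≡_; _≢_; refl; sym; trans; cong)

agree-sym : ∀ {k x y} → Agree k x y → Agree k y x
agree-sym a i i<k = sym (a i i<k)

agree-trans : ∀ {k x y z} → Agree k x y → Agree k y z → Agree k x z
agree-trans a b i i<k = trans (a i i<k) (b i i<k)

agree-mono : ∀ {k k' x y} → k ≤ k' → Agree k' x y → Agree k x y
agree-mono k≤k' a i i<k = a i (<-≤-trans i<k k≤k')

agree-zero : ∀ {x y} → Agree 0 x y
agree-zero i ()

agree-suc : ∀ {k x y} → Agree k x y → x k ≡ y k → Agree (suc k) x y
agree-suc {k} a eq i i<sk with m<1+n⇒m<n∨m≡n i<sk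
... | inj₁ i<k = a i i<k
... | inj₂ refl = eq

LocallyConstant : (Cantor → ℕ) → Set
LocallyConstant h = ∀ x → ∃[ k ] (∀ y → Agree k x y → h y ≡ h x)

LocallyConstantOn : (C : Subset) → ((x : Cantor) → C x → ℕ) → Set
LocallyConstantOn C g =
  ∀ x (p : C x) → ∃[ k ] (∀ y (q : C y) → Agree k x y → g y q ≡ g x p)

flipAt : ℕ → Cantor → Cantor
flipAt k s i with i ≟ k
... | yes _ = not (s i)
... | no _ = s i

flipAt-here : ∀ k s → flipAt k s k ≡ not (s k)
flipAt-here k s with k ≟ k
... | yes _ = refl
... | no k≢k = ⊥-elim (k≢k refl)

flipAt-other : ∀ {i k} s → i ≢ k → flipAt k s i ≡ s i
flipAt-other {i} {k} s i≢k with i ≟ k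
... | yes i≡k = ⊥-elim (i≢k i≡k)
... | no _ = refl

flipAt-agree : ∀ {k j s t} → Agree k s t → Agree k (flipAt j s) (flipAt j t)
flipAt-agree {j = j} a i i<k with i ≟ j
... | yes _ = cong not (a i i<k)
... | no _ = a i i<k

module Retraction (em : ExcludedMiddle 0ℓ) (C : Subset) where

  Meets : ℕ → Cantor → Set
  Meets k s = ∃[ z ] (C z × Agree k s z)

  meets-resp : ∀ {k s t} → Agree k s t → Meets k s → Meets k t
  meets-resp a (z , Cz , b) = z , Cz , agree-trans (agree-sym a) b

  flipAt-meets : ∀ {k s} → Meets k s → ¬ Meets (suc k) s → Meets (suc k) (flipAt k s)
  flipAt-meets {k} {s} (z , Cz , a) ¬meets = z , Cz , agree-suc shifted flipped
    where
    shifted : Agree k (flipAt k s) z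
    shifted i i<k = trans (flipAt-other s (<⇒≢ i<k)) (a i i<k)

    flipped : flipAt k s k ≡ z k
    flipped = trans (flipAt-here k s)
                    (sym (¬-not λ zk≡sk → ¬meets (z , Cz , agree-suc a (sym zk≡sk))))

  step : (k : ℕ) (s : Cantor) → Dec (Meets (suc k) s) → Cantor
  step k s (yes _) = s
  step k s (no _) = flipAt k s

  stage : ℕ → Cantor → Cantor
  stage zero y = y
  stage (suc k) y = step k (stage k y) em

  retract : Cantor → Cantor
  retract y i = stage (suc i) y i

  step-meets : ∀ {k s} → Meets k s → (d : Dec (Meets (suc k) s)) → Meets (suc k) (step k s d)
  step-meets _ (yes meets) = meets
  step-meets meets (no ¬meets) = flipAt-meets meets ¬meets

  step-other : ∀ {i k s} (d : Dec (Meets (suc k) s)) → i ≢ k → step k s d i ≡ s i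
  step-other (yes _) _ = refl
  step-other {s = s} (no _) i≢k = flipAt-other s i≢k

  step-agree : ∀ {j k s t} → Agree k s t → j < k →
    (d : Dec (Meets (suc j) s)) (e : Dec (Meets (suc j) t)) → Agree k (step j s d) (step j t e)
  step-agree a _ (yes _) (yes _) = a
  step-agree a _ (no _) (no _) = flipAt-agree a
  step-agree a j<k (yes meets) (no ¬meets) = ⊥-elim (¬meets (meets-resp (agree-mono j<k a) meets))
  step-agree a j<k (no ¬meets) (yes meets) =
    ⊥-elim (¬meets (meets-resp (agree-sym (agree-mono j<k a)) meets))

  stage-meets : ∀ {c} → C c → ∀ k y → Meets k (stage k y)
  stage-meets Cc zero y = _ , Cc , agree-zero
  stage-meets Cc (suc k) y = step-meets (stage-meets Cc k y) em

  stage-settled : ∀ {i} j y → i < j → stage j y i ≡ stage (suc i) y i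
  stage-settled {i} (suc j) y i<sj with m<1+n⇒m<n∨m≡n i<sj
  ... | inj₁ i<j = trans (step-other em (<⇒≢ i<j)) (stage-settled j y i<j)
  ... | inj₂ refl = refl

  stage-agree : ∀ {k x y} → Agree k x y → ∀ j → j ≤ k → Agree k (stage j x) (stage j y)
  stage-agree a zero _ = a
  stage-agree a (suc j) j<k = step-agree (stage-agree a j (<⇒≤ j<k)) j<k em em

  retract-agrees-stage : ∀ k y → Agree k (retract y) (stage k y)
  retract-agrees-stage k y i i<k = sym (stage-settled k y i<k)

  retract-∈ : Closed C → ∀ {c} → C c → ∀ y → C (retract y)
  retract-∈ closed Cc y = closed (retract y) λ k →
    let (z , Cz , a) = stage-meets Cc k y
    in z , Cz , agree-trans (retract-agrees-stage k y) a

  stage-fixes : ∀ {y} → C y → ∀ k i → stage k y i ≡ y i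
  stage-fixes Cy zero i = refl
  stage-fixes {y} Cy (suc k) = fixed em
    where
    fixed : (d : Dec (Meets (suc k) (stage k y))) → ∀ i → step k (stage k y) d i ≡ y i
    fixed (yes _) = stage-fixes Cy k
    fixed (no ¬meets) = ⊥-elim (¬meets (y , Cy , λ i _ → stage-fixes Cy k i))

  retract-fixes : ∀ {y} → C y → ∀ k → Agree k y (retract y)
  retract-fixes Cy k i _ = sym (stage-fixes Cy (suc i) i)

  retract-continuous : ∀ {k x y} → Agree k x y → Agree k (retract x) (retract y)
  retract-continuous a i i<k = stage-agree a (suc i) i<k i i<k

extend-locally-constant : ExcludedMiddle 0ℓ → (C : Subset) → Closed C →
  (g : (x : Cantor) → C x → ℕ) → LocallyConstantOn C g →
  Σ (Cantor → ℕ) λ h → LocallyConstant h × (∀ x (p : C x) → h x ≡ g x p)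
extend-locally-constant em C closed g g-const with em {∃ C}
... | no empty = (λ _ → 0) , (λ _ → 0 , λ _ _ → refl) , λ x p → ⊥-elim (empty (x , p))
... | yes (c , Cc) = h , h-const , h-extends
  where
  open Retraction em C

  r∈C : ∀ y → C (retract y)
  r∈C = retract-∈ closed Cc

  h : Cantor → ℕ
  h y = g (retract y) (r∈C y)

  h-const : LocallyConstant h
  h-const x with g-const (retract x) (r∈C x)
  ... | k , const = k , λ y a → const (retract y) (r∈C y) (retract-continuous a)

  h-extends : ∀ x (p : C x) → h x ≡ g x p
  h-extends x p with g-const x p
  ... | k , const = const (retract x) (r∈C x) (retract-fixes p k)

Absorbing : ℕ → Subset → Cantor → Set
Absorbing K A y = ∀ z → A z → Agree K y z → A y

absorbing-mono : ∀ {K K' y} {A : Subset} → K ≤ K' → Absorbing K A y → Absorbing K' A y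
absorbing-mono K≤K' absorb z Az a = absorb z Az (agree-mono K≤K' a)

closed⇒absorbing : ExcludedMiddle 0ℓ → {A : Subset} → Closed A → ∀ y → ∃[ K ] Absorbing K A y
closed⇒absorbing em {A} closed y = decidable-stable em λ none →
  let ¬Ay : ¬ A y
      ¬Ay Ay = none (0 , λ _ _ _ → Ay)
  in ¬Ay (closed y λ k → decidable-stable em λ ¬near →
       none (k , λ z Az a → ⊥-elim (¬near (z , Az , a))))

bound-below : ∀ {P : ℕ → ℕ → Set} → (∀ {j K K'} → K ≤ K' → P j K → P j K') →
  ∀ m → (∀ j → j ≤ m → ∃ (P j)) → ∃[ K ] (∀ j → j ≤ m → P j K)
bound-below mono zero bounds with bounds 0 z≤n
... | K , P0K = K , λ { .zero z≤n → P0K }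
bound-below {P} mono (suc m) bounds
  with bound-below mono m (λ j j≤m → bounds j (m≤n⇒m≤1+n j≤m)) | bounds (suc m) ≤-refl
... | K , below | K' , top = K ⊔ K' , combined
  where
  combined : ∀ j → j ≤ suc m → P j (K ⊔ K')
  combined j j≤sm with m≤n⇒m<n∨m≡n j≤sm
  ... | inj₁ j<sm = mono (m≤m⊔n K K') (below j (≤-pred j<sm))
  ... | inj₂ refl = mono (m≤n⊔m K K') top

⋃≤ : (ℕ → Subset) → ℕ → Subset
⋃≤ X m z = ∃[ j ] (j ≤ m × X j z)

⋃≤-absorbing : ExcludedMiddle 0ℓ → {X : ℕ → Subset} → (∀ n → Closed (X n)) →
  ∀ m y → ∃[ K ] (∀ j → j ≤ m → Absorbing K (X j) y)
⋃≤-absorbing em {X} closed m y =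
  bound-below {P = λ j K → Absorbing K (X j) y} absorbing-mono m λ j _ → closed⇒absorbing em (closed j) y

⋃≤-closed : ExcludedMiddle 0ℓ → {X : ℕ → Subset} → (∀ n → Closed (X n)) → ∀ m → Closed (⋃≤ X m)
⋃≤-closed em {X} closed m x near with ⋃≤-absorbing em {X} closed m x
... | K , absorb with near K
...   | z , (j , j≤m , Xjz) , a = j , j≤m , absorb j j≤m z Xjz a

glue : {X : ℕ → Subset} → ((n : ℕ) → (x : Cantor) → X n x → Baire) → (m : ℕ) → (x : Cantor) → ⋃≤ X m x → ℕ
glue F m x (j , _ , p) = F j x p m

glue-locally-constant : ExcludedMiddle 0ℓ → {X : ℕ → Subset} → (∀ n → Closed (X n)) →
  (∀ x n n' → X n x → X n' x → n ≡ n') →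
  (F : (n : ℕ) → (x : Cantor) → X n x → Baire) → (∀ n → ContinuousOn (X n) (F n)) →
  ∀ m → LocallyConstantOn (⋃≤ X m) (glue F m)
glue-locally-constant em {X} closed disjoint F F-cont m x (j , j≤m , p)
  with ⋃≤-absorbing em {X} closed m x | F-cont j x p m
... | K , absorb | k , F-const = K ⊔ k , λ { y (j' , j'≤m , q) a →
        same-piece (disjoint x j' j (absorb j' j'≤m y q (agree-mono (m≤m⊔n K k) a)) p) q
                   (agree-mono (m≤n⊔m K k) a) }
  where
  same-piece : ∀ {j' y} → j' ≡ j → (q : X j' y) → Agree k x y → F j' y q m ≡ F j x p m
  same-piece refl q a = F-const _ q a

lemma2p10 : ExcludedMiddle 0ℓ →
    (X : ℕ → Subset) → (∀ n → Closed (X n)) → IsPartition X →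
    (F : (n : ℕ) → (x : Cantor) → X n x → Baire) →
    (∀ n → ContinuousOn (X n) (F n)) →
    Σ (Cantor → Baire) λ f → Continuous f ×
    (∀ n x (p : X n x) m → n ≤ m → f x m ≡ F n x p m)
lemma2p10 em X closed (_ , disjoint) F F-cont = f , f-continuous , f-extends
  where
  extension : ∀ m → Σ (Cantor → ℕ) λ h →
    LocallyConstant h × (∀ x (p : ⋃≤ X m x) → h x ≡ glue F m x p)
  extension m = extend-locally-constant em (⋃≤ X m) (⋃≤-closed em closed m) (glue F m)
                  (glue-locally-constant em closed disjoint F F-cont m)

  f : Cantor → Baire
  f x m = proj₁ (extension m) x

  f-continuous : Continuous f
  f-continuous x m = proj₁ (proj₂ (extension m)) x

  f-extends : ∀ n x (p : X n x) m → n ≤ m → f x m ≡ F n x p m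
  f-extends n x p m n≤m = proj₂ (proj₂ (extension m)) x (n , n≤m , p)
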